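{- Let $p$ be a prime and $k\ge1$. Let $G$ be a difference matrix in $D(p^k,p^k,\mathbb{Z}_p^k)$, and let $G_1,\dots,G_k$ be the $p^k\times p^k$ matrices over $\mathbb{Z}_p$ obtained from $G$ by taking respectively the first, ..., the $k$-th coordinate of each entry. Let $0\le h_1,\dots,h_k<p$ with $(h_1,\dots,h_k)\neq(0,\dots,0)$. Then $H=h_1G_1+\cdots+h_kG_k$ is a difference matrix in $D(p^k,p^k,\mathbb{Z}_p)$.
   Context: $\mathbb{Z}_p=\mathbb{Z}/p\mathbb{Z}$. For a finite abelian group $A$, a difference matrix of size $r\times c$ over $A$ is a matrix $(d_{ij})$ with entries in $A$ such that for all distinct columns $i\neq j$ the multiset $\{d_{li}-d_{lj}:1\le l\le r\}$ contains every element of $A$ equally often; $D(r,c,A)$ is the set of such matrices. -}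

module Defs where

open import Data.Nat using (ℕ; zero; suc; _+_; _*_; _^_; NonZero)
open import Data.Nat.DivMod using (_%_; _mod_)
open import Data.Fin using (Fin; toℕ)
open import Data.Fin.Properties using (_≟_)
open import Data.Vec using (Vec; zipWith; lookup; []; _∷_)
open import Data.Vec.Properties using (≡-dec)
open import Data.Product using (_×_; Σ; _,_)
open import Relation.Nullary using (Dec; yes; no; ¬_)
open import Relation.Binary.PropositionalEquality using (_≡_)
open import Relation.Binary using (DecidableEquality)

countFin : (r : ℕ) → (P : Fin r → Set) → ((l : Fin r) → Dec (P l)) → ℕ
countFin zero P dec = 0
countFin (suc r) P dec with dec Fin.zero
... | yes _ = suc (countFin r (λ l → P (Fin.suc l)) (λ l → dec (Fin.suc l)))
... | no  _ = countFin r (λ l → P (Fin.suc l)) (λ l → dec (Fin.suc l))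

-- A finite abelian group, presented concretely by a carrier with decidable
-- equality and a subtraction (only subtraction enters the definition).
IsDifferenceMatrix : {A : Set} → DecidableEquality A → (A → A → A) →
                     (r c : ℕ) → (Fin r → Fin c → A) → Set
IsDifferenceMatrix {A} eq sub r c d =
  (i j : Fin c) → ¬ (i ≡ j) → (a b : A) →
    countFin r (λ l → sub (d l i) (d l j) ≡ a) (λ l → eq (sub (d l i) (d l j)) a)
  ≡ countFin r (λ l → sub (d l i) (d l j) ≡ b) (λ l → eq (sub (d l i) (d l j)) b)

module Zmod (p : ℕ) .{{_ : NonZero p}} where
  Zp : Set
  Zp = Fin p

  _+p_ : Zp → Zp → Zp
  x +p y = (toℕ x + toℕ y) mod p

  _*p_ : Zp → Zp → Zp
  x *p y = (toℕ x * toℕ y) mod p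

  -p_ : Zp → Zp
  -p x = (p Data.Nat.∸ toℕ x) mod p

  _-p_ : Zp → Zp → Zp
  x -p y = x +p (-p y)

  0p : Zp
  0p = 0 mod p

  Zpk : ℕ → Set
  Zpk k = Vec Zp k

  _-pk_ : {k : ℕ} → Zpk k → Zpk k → Zpk k
  x -pk y = zipWith _-p_ x y

  eqPk : (k : ℕ) → DecidableEquality (Zpk k)
  eqPk k = ≡-dec _≟_

  linComb : {k : ℕ} → Vec Zp k → Vec Zp k → Zp
  linComb []       []       = 0p
  linComb (h ∷ hs) (x ∷ xs) = (h *p x) +p linComb hs xs

{-# OPTIONS --safe #-}
-- The linear form φ(x) = h₁x₁ + ⋯ + h_k x_k is a homomorphism ℤ_p^k → ℤ_p, and
-- it is onto because some hᵢ is a unit of ℤ_p.  Since H's row differences are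
-- φ applied to G's, the number of rows l with H l i - H l j = a is the sum,
-- over v ∈ φ⁻¹(a), of the number of rows with G l i - G l j = v.  The latter
-- does not depend on v, and all fibres of the onto homomorphism φ have the
-- same size (they are translates of each other), so the count is independent
-- of a.
module Submission where

open import Defs
open import Algebra.Bundles using (AbelianGroup)
open import Data.Bool using (true; false; if_then_else_)
open import Data.Nat using (ℕ; zero; suc; _+_; _*_; _∸_; _%_; _≤_; _<_; _^_; NonZero; ≢-nonZero)
open import Data.Nat.Properties as ℕ using (+-*-semiring)
open import Data.Nat.DivMod using (_mod_; %-distribˡ-+; %-distribˡ-*; m%n%n≡m%n; n%n≡0; m*n%n≡0; m<n⇒m%n≡m; [m+kn]%n≡m%n)
open import Data.Nat.Coprimality using (prime⇒coprime; coprime-Bézout)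
open import Data.Nat.GCD using (module Bézout)
open import Data.Nat.Primality using (Prime; prime⇒nonZero)
open import Data.Nat.Tactic.RingSolver using (solve-∀)
open import Data.Fin using (Fin; _≟_; toℕ)
open import Data.Fin.Properties using (toℕ-fromℕ<; toℕ-injective; toℕ<n)
open import Data.Fin.Permutation using (permutation)
open import Data.Vec using (Vec; replicate; []; _∷_)
open import Data.Vec.Properties using (≡-dec)
open import Data.Product using (∃-syntax; _,_; proj₁; proj₂)
open import Data.Empty using (⊥-elim)
open import Function using (_∘_; _⇔_; mk⇔)
open import Relation.Binary using (DecidableEquality)
open import Relation.Binary.PropositionalEquality using (_≡_; _≢_; refl; sym; trans; cong; cong₂; isEquivalence; module ≡-Reasoning)
open import Relation.Nullary using (¬_; Dec; yes; no; does; _×-dec_)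
open import Relation.Nullary.Decidable using (does-⇔)

open import Algebra.Properties.Semiring.Sum +-*-semiring
  using (sum-syntax; sum-cong-≗; sum-replicate-zero; ∑-comm; ∑-permute; *-distribˡ-sum; *-distribʳ-sum)

open ≡-Reasoning

𝟙 : {P : Set} → Dec P → ℕ
𝟙 P? = if does P? then 1 else 0

𝟙-⇔ : {P Q : Set} → P ⇔ Q → (P? : Dec P) (Q? : Dec Q) → 𝟙 P? ≡ 𝟙 Q?
𝟙-⇔ P⇔Q P? Q? = cong (λ b → if b then 1 else 0) (does-⇔ P⇔Q P? Q?)

𝟙-×-dec : {P Q : Set} (P? : Dec P) (Q? : Dec Q) → 𝟙 (P? ×-dec Q?) ≡ 𝟙 P? * 𝟙 Q?
𝟙-×-dec P? Q? with does P?
... | true  = sym (ℕ.+-identityʳ (𝟙 Q?))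
... | false = refl

countFin≡∑𝟙 : ∀ r (P : Fin r → Set) (P? : ∀ l → Dec (P l)) →
              countFin r P P? ≡ ∑[ l < r ] 𝟙 (P? l)
countFin≡∑𝟙 zero    P P? = refl
countFin≡∑𝟙 (suc r) P P? with P? Fin.zero
... | yes _ = cong suc (countFin≡∑𝟙 r _ _)
... | no  _ = countFin≡∑𝟙 r _ _

∑-δ : ∀ {n} (z : Fin n) (g : Fin n → ℕ) → ∑[ y < n ] (𝟙 (z ≟ y) * g y) ≡ g z
∑-δ {suc n} Fin.zero    g =
  trans (cong₂ _+_ (ℕ.*-identityˡ (g Fin.zero)) (sum-replicate-zero n)) (ℕ.+-identityʳ _)
∑-δ {suc n} (Fin.suc z) g = ∑-δ z (g ∘ Fin.suc)

∑ᵥ : ∀ {n} k → (Vec (Fin n) k → ℕ) → ℕ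
∑ᵥ         zero    F = F []
∑ᵥ {n = n} (suc k) F = ∑[ x < n ] ∑ᵥ k (λ v → F (x ∷ v))

module _ {n : ℕ} where

  ∑ᵥ-cong : ∀ k {F G : Vec (Fin n) k → ℕ} → (∀ v → F v ≡ G v) → ∑ᵥ k F ≡ ∑ᵥ k G
  ∑ᵥ-cong zero    F≗G = F≗G []
  ∑ᵥ-cong (suc k) F≗G = sum-cong-≗ (λ x → ∑ᵥ-cong k (F≗G ∘ (x ∷_)))

  ∑ᵥ-distribˡ : ∀ k c (F : Vec (Fin n) k → ℕ) → ∑ᵥ k (λ v → c * F v) ≡ c * ∑ᵥ k F
  ∑ᵥ-distribˡ zero    c F = refl
  ∑ᵥ-distribˡ (suc k) c F = trans (sum-cong-≗ (λ x → ∑ᵥ-distribˡ k c (F ∘ (x ∷_))))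
                                  (sym (*-distribˡ-sum c (λ x → ∑ᵥ k (F ∘ (x ∷_)))))

  ∑-∑ᵥ-comm : ∀ r k (F : Fin r → Vec (Fin n) k → ℕ) →
              ∑[ l < r ] ∑ᵥ k (F l) ≡ ∑ᵥ k (λ v → ∑[ l < r ] F l v)
  ∑-∑ᵥ-comm r zero    F = refl
  ∑-∑ᵥ-comm r (suc k) F = trans (∑-comm (λ l x → ∑ᵥ k (F l ∘ (x ∷_))))
                                (sum-cong-≗ (λ x → ∑-∑ᵥ-comm r k (λ l → F l ∘ (x ∷_))))

  ∑ᵥ-δ : ∀ k (w : Vec (Fin n) k) (g : Vec (Fin n) k → ℕ) →
         ∑ᵥ k (λ v → 𝟙 (≡-dec _≟_ w v) * g v) ≡ g w
  ∑ᵥ-δ zero    []      g = ℕ.*-identityˡ (g [])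
  ∑ᵥ-δ (suc k) (x ∷ w) g = begin
    ∑[ y < n ] ∑ᵥ k (λ v → 𝟙 (≡-dec _≟_ (x ∷ w) (y ∷ v)) * g (y ∷ v))
      ≡⟨ sum-cong-≗ (λ y → ∑ᵥ-cong k (λ v → split y v)) ⟩
    ∑[ y < n ] ∑ᵥ k (λ v → 𝟙 (x ≟ y) * (𝟙 (≡-dec _≟_ w v) * g (y ∷ v)))
      ≡⟨ sum-cong-≗ (λ y → ∑ᵥ-distribˡ k (𝟙 (x ≟ y)) _) ⟩
    ∑[ y < n ] (𝟙 (x ≟ y) * ∑ᵥ k (λ v → 𝟙 (≡-dec _≟_ w v) * g (y ∷ v)))
      ≡⟨ sum-cong-≗ (λ y → cong (𝟙 (x ≟ y) *_) (∑ᵥ-δ k w (g ∘ (y ∷_)))) ⟩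
    ∑[ y < n ] (𝟙 (x ≟ y) * g (y ∷ w))
      ≡⟨ ∑-δ x (λ y → g (y ∷ w)) ⟩
    g (x ∷ w) ∎
    where
    split : ∀ y v → 𝟙 (≡-dec _≟_ (x ∷ w) (y ∷ v)) * g (y ∷ v)
                  ≡ 𝟙 (x ≟ y) * (𝟙 (≡-dec _≟_ w v) * g (y ∷ v))
    split y v = trans (cong (_* g (y ∷ v)) (𝟙-×-dec (x ≟ y) (≡-dec _≟_ w v)))
                      (ℕ.*-assoc (𝟙 (x ≟ y)) _ _)

  ∑𝟙-∘ : ∀ r k {B : Set} (_≟B_ : DecidableEquality B)
           (f : Fin r → Vec (Fin n) k) (φ : Vec (Fin n) k → B) (b : B) →
         ∑[ l < r ] 𝟙 (φ (f l) ≟B b)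
         ≡ ∑ᵥ k (λ v → (∑[ l < r ] 𝟙 (≡-dec _≟_ (f l) v)) * 𝟙 (φ v ≟B b))
  ∑𝟙-∘ r k _≟B_ f φ b = begin
    ∑[ l < r ] 𝟙 (φ (f l) ≟B b)
      ≡⟨ sum-cong-≗ (λ l → sym (∑ᵥ-δ k (f l) (λ v → 𝟙 (φ v ≟B b)))) ⟩
    ∑[ l < r ] ∑ᵥ k (λ v → 𝟙 (≡-dec _≟_ (f l) v) * 𝟙 (φ v ≟B b))
      ≡⟨ ∑-∑ᵥ-comm r k _ ⟩
    ∑ᵥ k (λ v → ∑[ l < r ] (𝟙 (≡-dec _≟_ (f l) v) * 𝟙 (φ v ≟B b)))
      ≡⟨ ∑ᵥ-cong k (λ v → sym (*-distribʳ-sum (𝟙 (φ v ≟B b)) (λ l → 𝟙 (≡-dec _≟_ (f l) v)))) ⟩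
    ∑ᵥ k (λ v → (∑[ l < r ] 𝟙 (≡-dec _≟_ (f l) v)) * 𝟙 (φ v ≟B b)) ∎

module _ {d : ℕ} .{{_ : NonZero d}} where

  %-absorbˡ-+ : ∀ m n → (m % d + n) % d ≡ (m + n) % d
  %-absorbˡ-+ m n = begin
    (m % d + n) % d           ≡⟨ %-distribˡ-+ (m % d) n d ⟩
    (m % d % d + n % d) % d   ≡⟨ cong (λ t → (t + n % d) % d) (m%n%n≡m%n m d) ⟩
    (m % d + n % d) % d       ≡⟨ %-distribˡ-+ m n d ⟨
    (m + n) % d               ∎

  %-absorbʳ-+ : ∀ m n → (m + n % d) % d ≡ (m + n) % d
  %-absorbʳ-+ m n = begin
    (m + n % d) % d ≡⟨ cong (_% d) (ℕ.+-comm m (n % d)) ⟩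
    (n % d + m) % d ≡⟨ %-absorbˡ-+ n m ⟩
    (n + m) % d     ≡⟨ cong (_% d) (ℕ.+-comm n m) ⟩
    (m + n) % d     ∎

  %-absorbˡ-* : ∀ m n → (m % d * n) % d ≡ (m * n) % d
  %-absorbˡ-* m n = begin
    (m % d * n) % d           ≡⟨ %-distribˡ-* (m % d) n d ⟩
    (m % d % d * (n % d)) % d ≡⟨ cong (λ t → (t * (n % d)) % d) (m%n%n≡m%n m d) ⟩
    (m % d * (n % d)) % d     ≡⟨ %-distribˡ-* m n d ⟨
    (m * n) % d               ∎

  %-absorbʳ-* : ∀ m n → (m * (n % d)) % d ≡ (m * n) % d
  %-absorbʳ-* m n = begin
    (m * (n % d)) % d ≡⟨ cong (_% d) (ℕ.*-comm m (n % d)) ⟩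
    (n % d * m) % d   ≡⟨ %-absorbˡ-* n m ⟩
    (n * m) % d       ≡⟨ cong (_% d) (ℕ.*-comm n m) ⟩
    (m * n) % d       ∎

-- The two Bézout cases 1 + y h = x p and 1 + x p = y h give the inverses
-- (p - 1) y and y of h modulo p.
modular-inverse : ∀ {p h} .{{_ : NonZero p}} → Prime p → .{{_ : NonZero h}} → h < p →
                  ∃[ u ] (h * u) % p ≡ 1 % p
modular-inverse {p@(suc q)} {h} pr h<p with coprime-Bézout (prime⇒coprime pr h<p)
... | Bézout.+- x y 1+yh≡xp = y * q , (begin
  (h * (y * q)) % p             ≡⟨ [m+kn]%n≡m%n (h * (y * q)) x p ⟨
  (h * (y * q) + x * p) % p     ≡⟨ cong (λ t → (h * (y * q) + t) % p) 1+yh≡xp ⟨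
  (h * (y * q) + (1 + y * h)) % p ≡⟨ cong (_% p) (rearrange h y q) ⟩
  (1 + y * h * p) % p           ≡⟨ [m+kn]%n≡m%n 1 (y * h) p ⟩
  1 % p                         ∎)
  where
  rearrange : ∀ h y q → h * (y * q) + (1 + y * h) ≡ 1 + y * h * suc q
  rearrange = solve-∀
... | Bézout.-+ x y 1+xp≡yh = y , (begin
  (h * y) % p     ≡⟨ cong (_% p) (trans (ℕ.*-comm h y) (sym 1+xp≡yh)) ⟩
  (1 + x * p) % p ≡⟨ [m+kn]%n≡m%n 1 x p ⟩
  1 % p           ∎)

module _ (p : ℕ) .{{_ : NonZero p}} where

  open Zmod p

  toℕ-mod : ∀ n → toℕ (n mod p) ≡ n % p
  toℕ-mod n = toℕ-fromℕ< _

  toℕ-% : (x : Zp) → toℕ x % p ≡ toℕ x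
  toℕ-% x = m<n⇒m%n≡m (toℕ<n x)

  toℕ-0p : toℕ 0p ≡ 0
  toℕ-0p = trans (toℕ-mod 0) (m*n%n≡0 0 p)

  mod-cong : ∀ {m n} → m % p ≡ n % p → m mod p ≡ n mod p
  mod-cong {m} {n} eq = toℕ-injective (trans (toℕ-mod m) (trans eq (sym (toℕ-mod n))))

  +p-assoc : ∀ x y z → (x +p y) +p z ≡ x +p (y +p z)
  +p-assoc x y z = mod-cong (begin
    (toℕ (x +p y) + toℕ z) % p             ≡⟨ cong (λ t → (t + toℕ z) % p) (toℕ-mod _) ⟩
    ((toℕ x + toℕ y) % p + toℕ z) % p       ≡⟨ %-absorbˡ-+ (toℕ x + toℕ y) (toℕ z) ⟩
    (toℕ x + toℕ y + toℕ z) % p             ≡⟨ cong (_% p) (ℕ.+-assoc (toℕ x) (toℕ y) (toℕ z)) ⟩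
    (toℕ x + (toℕ y + toℕ z)) % p           ≡⟨ %-absorbʳ-+ (toℕ x) (toℕ y + toℕ z) ⟨
    (toℕ x + (toℕ y + toℕ z) % p) % p       ≡⟨ cong (λ t → (toℕ x + t) % p) (toℕ-mod _) ⟨
    (toℕ x + toℕ (y +p z)) % p              ∎)

  +p-comm : ∀ x y → x +p y ≡ y +p x
  +p-comm x y = cong (_mod p) (ℕ.+-comm (toℕ x) (toℕ y))

  +p-identityʳ : ∀ x → x +p 0p ≡ x
  +p-identityʳ x = toℕ-injective (begin
    toℕ (x +p 0p)          ≡⟨ toℕ-mod _ ⟩
    (toℕ x + toℕ 0p) % p   ≡⟨ cong (λ t → (toℕ x + t) % p) toℕ-0p ⟩
    (toℕ x + 0) % p        ≡⟨ cong (_% p) (ℕ.+-identityʳ (toℕ x)) ⟩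
    toℕ x % p              ≡⟨ toℕ-% x ⟩
    toℕ x                  ∎)

  +p-inverseʳ : ∀ x → x +p (-p x) ≡ 0p
  +p-inverseʳ x = toℕ-injective (begin
    toℕ (x +p (-p x))                ≡⟨ toℕ-mod _ ⟩
    (toℕ x + toℕ (-p x)) % p         ≡⟨ cong (λ t → (toℕ x + t) % p) (toℕ-mod _) ⟩
    (toℕ x + (p ∸ toℕ x) % p) % p    ≡⟨ %-absorbʳ-+ (toℕ x) (p ∸ toℕ x) ⟩
    (toℕ x + (p ∸ toℕ x)) % p        ≡⟨ cong (_% p) (ℕ.m+[n∸m]≡n (ℕ.<⇒≤ (toℕ<n x))) ⟩
    p % p                            ≡⟨ n%n≡0 p ⟩
    0                                ≡⟨ toℕ-0p ⟨
    toℕ 0p                           ∎)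

  +p-abelianGroup : AbelianGroup _ _
  +p-abelianGroup = record
    { _≈_            = _≡_
    ; _∙_            = _+p_
    ; ε              = 0p
    ; _⁻¹            = λ x → -p x
    ; isAbelianGroup = record
      { isGroup = record
        { isMonoid = record
          { isSemigroup = record
            { isMagma = record { isEquivalence = isEquivalence ; ∙-cong = cong₂ _+p_ }
            ; assoc   = +p-assoc
            }
          ; identity = (λ x → trans (+p-comm 0p x) (+p-identityʳ x)) , +p-identityʳ
          }
        ; inverse = (λ x → trans (+p-comm (-p x) x) (+p-inverseʳ x)) , +p-inverseʳ
        ; ⁻¹-cong = cong (λ x → -p x)
        }
      ; comm    = +p-comm
      }
    }

  open AbelianGroup +p-abelianGroup using (identityˡ; identityʳ; inverseʳ)
  open import Algebra.Properties.AbelianGroup +p-abelianGroup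
    using (inverseʳ-unique; ⁻¹-∙-comm; //-rightDividesˡ; //-rightDividesʳ)
  open import Algebra.Properties.CommutativeSemigroup
    (AbelianGroup.commutativeSemigroup +p-abelianGroup) using (interchange)

  *p-distribˡ-+p : ∀ h x y → h *p (x +p y) ≡ (h *p x) +p (h *p y)
  *p-distribˡ-+p h x y = mod-cong (begin
    (toℕ h * toℕ (x +p y)) % p                     ≡⟨ cong (λ t → (toℕ h * t) % p) (toℕ-mod _) ⟩
    (toℕ h * ((toℕ x + toℕ y) % p)) % p            ≡⟨ %-absorbʳ-* (toℕ h) (toℕ x + toℕ y) ⟩
    (toℕ h * (toℕ x + toℕ y)) % p                  ≡⟨ cong (_% p) (ℕ.*-distribˡ-+ (toℕ h) (toℕ x) (toℕ y)) ⟩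
    (toℕ h * toℕ x + toℕ h * toℕ y) % p            ≡⟨ %-distribˡ-+ (toℕ h * toℕ x) (toℕ h * toℕ y) p ⟩
    ((toℕ h * toℕ x) % p + (toℕ h * toℕ y) % p) % p ≡⟨ cong₂ (λ s t → (s + t) % p) (toℕ-mod _) (toℕ-mod _) ⟨
    (toℕ (h *p x) + toℕ (h *p y)) % p              ∎)

  *p-zeroʳ : ∀ h → h *p 0p ≡ 0p
  *p-zeroʳ h = trans (cong (λ t → (toℕ h * t) mod p) toℕ-0p) (cong (_mod p) (ℕ.*-zeroʳ (toℕ h)))

  *p-distribˡ--p : ∀ h x y → h *p (x -p y) ≡ (h *p x) -p (h *p y)
  *p-distribˡ--p h x y = trans (*p-distribˡ-+p h x (-p y)) (cong ((h *p x) +p_) *p-neg)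
    where
    *p-neg : h *p (-p y) ≡ -p (h *p y)
    *p-neg = inverseʳ-unique (h *p y) (h *p (-p y))
      (trans (sym (*p-distribˡ-+p h y (-p y))) (trans (cong (h *p_) (inverseʳ y)) (*p-zeroʳ h)))

  *p-surjective : Prime p → ∀ {h} → h ≢ 0p → ∀ a → ∃[ c ] h *p c ≡ a
  *p-surjective pr {h} h≢0 a = (u * toℕ a) mod p , toℕ-injective (begin
    toℕ (h *p ((u * toℕ a) mod p))            ≡⟨ toℕ-mod _ ⟩
    (toℕ h * toℕ ((u * toℕ a) mod p)) % p     ≡⟨ cong (λ t → (toℕ h * t) % p) (toℕ-mod _) ⟩
    (toℕ h * ((u * toℕ a) % p)) % p           ≡⟨ %-absorbʳ-* (toℕ h) (u * toℕ a) ⟩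
    (toℕ h * (u * toℕ a)) % p                 ≡⟨ cong (_% p) (ℕ.*-assoc (toℕ h) u (toℕ a)) ⟨
    (toℕ h * u * toℕ a) % p                   ≡⟨ %-absorbˡ-* (toℕ h * u) (toℕ a) ⟨
    ((toℕ h * u) % p * toℕ a) % p             ≡⟨ cong (λ t → (t * toℕ a) % p) hu≡1 ⟩
    (1 % p * toℕ a) % p                       ≡⟨ %-absorbˡ-* 1 (toℕ a) ⟩
    (1 * toℕ a) % p                           ≡⟨ cong (_% p) (ℕ.*-identityˡ (toℕ a)) ⟩
    toℕ a % p                                 ≡⟨ toℕ-% a ⟩
    toℕ a                                     ∎)
    where
    toℕh≢0 : toℕ h ≢ 0
    toℕh≢0 eq = h≢0 (toℕ-injective (trans eq (sym toℕ-0p)))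
    inverse : ∃[ u ] (toℕ h * u) % p ≡ 1 % p
    inverse = modular-inverse pr {{≢-nonZero toℕh≢0}} (toℕ<n h)
    u = proj₁ inverse
    hu≡1 = proj₂ inverse

  ∑-translate : (s : Zp) (g : Zp → ℕ) → ∑[ y < p ] g (y -p s) ≡ ∑[ y < p ] g y
  ∑-translate s g = sym (∑-permute g (permutation (_-p s) (_+p s) (//-rightDividesʳ s) (//-rightDividesˡ s)))

  ∑ᵥ-translate : ∀ k (s : Zpk k) (F : Zpk k → ℕ) → ∑ᵥ k (λ v → F (v -pk s)) ≡ ∑ᵥ k F
  ∑ᵥ-translate zero    []       F = refl
  ∑ᵥ-translate (suc k) (s₀ ∷ s) F = begin
    ∑[ y < p ] ∑ᵥ k (λ v → F ((y -p s₀) ∷ (v -pk s))) ≡⟨ sum-cong-≗ (λ y → ∑ᵥ-translate k s (F ∘ ((y -p s₀) ∷_))) ⟩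
    ∑[ y < p ] ∑ᵥ k (λ v → F ((y -p s₀) ∷ v))          ≡⟨ ∑-translate s₀ (λ y → ∑ᵥ k (F ∘ (y ∷_))) ⟩
    ∑[ y < p ] ∑ᵥ k (λ v → F (y ∷ v))                  ∎

  fibreSize : ∀ {k} → (Zpk k → Zp) → Zp → ℕ
  fibreSize {k} φ a = ∑ᵥ k (λ v → 𝟙 (φ v ≟ a))

  module _ {k} (φ : Zpk k → Zp) (φ-homo : ∀ x y → φ (x -pk y) ≡ φ x -p φ y)
               (φ-surjective : ∀ a → ∃[ s ] φ s ≡ a) where

    fibreSize-constant : ∀ a b → fibreSize φ a ≡ fibreSize φ b
    fibreSize-constant a b with s , φs≡a-b ← φ-surjective (a -p b) = begin
      ∑ᵥ k (λ v → 𝟙 (φ v ≟ a))          ≡⟨ ∑ᵥ-cong k (λ v → 𝟙-⇔ (shift v) (φ v ≟ a) (φ (v -pk s) ≟ b)) ⟩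
      ∑ᵥ k (λ v → 𝟙 (φ (v -pk s) ≟ b))  ≡⟨ ∑ᵥ-translate k s (λ v → 𝟙 (φ v ≟ b)) ⟩
      ∑ᵥ k (λ v → 𝟙 (φ v ≟ b))          ∎
      where
      φ[v-s] : ∀ v → φ (v -pk s) ≡ φ v -p (a -p b)
      φ[v-s] v = trans (φ-homo v s) (cong (λ t → φ v -p t) φs≡a-b)
      b+[a-b]≡a : b +p (a -p b) ≡ a
      b+[a-b]≡a = trans (+p-comm b (a -p b)) (//-rightDividesˡ b a)
      shift : ∀ v → φ v ≡ a ⇔ φ (v -pk s) ≡ b
      shift v = mk⇔
        (λ φv≡a → trans (φ[v-s] v) (trans (cong (_-p (a -p b)) (trans φv≡a (sym b+[a-b]≡a)))
                                           (//-rightDividesʳ (a -p b) b)))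
        (λ eq → trans (sym (//-rightDividesˡ (a -p b) (φ v)))
                      (trans (cong (_+p (a -p b)) (trans (sym (φ[v-s] v)) eq)) b+[a-b]≡a))

    IsDifferenceMatrix-map : ∀ {r c} (G : Fin r → Fin c → Zpk k) →
      IsDifferenceMatrix (eqPk k) _-pk_ r c G →
      IsDifferenceMatrix _≟_ _-p_ r c (λ l m → φ (G l m))
    IsDifferenceMatrix-map {r} G isDM i j i≢j a b = begin
      countFin r (λ l → H l ≡ a) (λ l → H l ≟ a) ≡⟨ count≡n₀*fibreSize a ⟩
      n₀ * fibreSize φ a                           ≡⟨ cong (n₀ *_) (fibreSize-constant a b) ⟩
      n₀ * fibreSize φ b                           ≡⟨ count≡n₀*fibreSize b ⟨
      countFin r (λ l → H l ≡ b) (λ l → H l ≟ b) ∎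
      where
      D : Fin r → Zpk k
      D l = G l i -pk G l j
      H : Fin r → Zp
      H l = φ (G l i) -p φ (G l j)
      n₀ : ℕ
      n₀ = countFin r (λ l → D l ≡ replicate k 0p) (λ l → eqPk k (D l) (replicate k 0p))
      count≡n₀*fibreSize : ∀ a → countFin r (λ l → H l ≡ a) (λ l → H l ≟ a) ≡ n₀ * fibreSize φ a
      count≡n₀*fibreSize a = begin
        countFin r (λ l → H l ≡ a) (λ l → H l ≟ a)
          ≡⟨ countFin≡∑𝟙 r _ _ ⟩
        ∑[ l < r ] 𝟙 (H l ≟ a)
          ≡⟨ sum-cong-≗ (λ l → 𝟙-⇔ (mk⇔ (trans (φ-homo _ _)) (trans (sym (φ-homo _ _)))) (H l ≟ a) (φ (D l) ≟ a)) ⟩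
        ∑[ l < r ] 𝟙 (φ (D l) ≟ a)
          ≡⟨ ∑𝟙-∘ r k _≟_ D φ a ⟩
        ∑ᵥ k (λ v → (∑[ l < r ] 𝟙 (eqPk k (D l) v)) * 𝟙 (φ v ≟ a))
          ≡⟨ ∑ᵥ-cong k (λ v → cong (_* 𝟙 (φ v ≟ a))
               (trans (sym (countFin≡∑𝟙 r _ _)) (isDM i j i≢j v (replicate k 0p)))) ⟩
        ∑ᵥ k (λ v → n₀ * 𝟙 (φ v ≟ a))
          ≡⟨ ∑ᵥ-distribˡ k n₀ _ ⟩
        n₀ * fibreSize φ a ∎

  linComb-homo : ∀ {k} (h x y : Zpk k) → linComb h (x -pk y) ≡ linComb h x -p linComb h y
  linComb-homo []       []       []       = sym (inverseʳ 0p)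
  linComb-homo (h ∷ hs) (x ∷ xs) (y ∷ ys) = begin
    (h *p (x -p y)) +p linComb hs (xs -pk ys)
      ≡⟨ cong₂ _+p_ (*p-distribˡ--p h x y) (linComb-homo hs xs ys) ⟩
    ((h *p x) +p (-p (h *p y))) +p (linComb hs xs +p (-p linComb hs ys))
      ≡⟨ interchange (h *p x) (-p (h *p y)) (linComb hs xs) (-p linComb hs ys) ⟩
    ((h *p x) +p linComb hs xs) +p ((-p (h *p y)) +p (-p linComb hs ys))
      ≡⟨ cong (((h *p x) +p linComb hs xs) +p_) (⁻¹-∙-comm (h *p y) (linComb hs ys)) ⟩
    ((h *p x) +p linComb hs xs) -p ((h *p y) +p linComb hs ys) ∎

  linComb-zeroʳ : ∀ {k} (h : Zpk k) → linComb h (replicate k 0p) ≡ 0p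
  linComb-zeroʳ []       = refl
  linComb-zeroʳ (h ∷ hs) = trans (cong₂ _+p_ (*p-zeroʳ h) (linComb-zeroʳ hs)) (identityʳ 0p)

  linComb-surjective : Prime p → ∀ {k} (h : Zpk k) → h ≢ replicate k 0p →
                       ∀ a → ∃[ s ] linComb h s ≡ a
  linComb-surjective pr []       h≢0 a = ⊥-elim (h≢0 refl)
  linComb-surjective pr (h₀ ∷ h) h≢0 a with h₀ ≟ 0p
  ... | yes refl =
    let s , hs≡a = linComb-surjective pr h (h≢0 ∘ cong (0p ∷_)) a
    in  0p ∷ s , trans (cong₂ _+p_ (*p-zeroʳ 0p) hs≡a) (identityˡ a)
  ... | no h₀≢0 =
    let c , h₀c≡a = *p-surjective pr h₀≢0 a
    in  c ∷ replicate _ 0p , trans (cong₂ _+p_ h₀c≡a (linComb-zeroʳ h)) (identityʳ a)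

lemma1 : (p k : ℕ) → (pr : Prime p) → 1 ≤ k →
    let open Zmod p {{prime⇒nonZero pr}} in
    (G : Fin (p ^ k) → Fin (p ^ k) → Zpk k) →
    IsDifferenceMatrix (eqPk k) _-pk_ (p ^ k) (p ^ k) G →
    (h : Vec Zp k) → ¬ (h ≡ replicate k 0p) →
    IsDifferenceMatrix _≟_ _-p_ (p ^ k) (p ^ k) (λ l m → linComb h (G l m))
lemma1 p k pr _ G isDM h h≢0 =
  IsDifferenceMatrix-map p (linComb h) (linComb-homo p h) (linComb-surjective p pr h h≢0) G isDM
  where
  instance _ = prime⇒nonZero pr
  open Zmod p using (linComb)
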